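{- Let $\mathfrak{M}=\langle W,R,v^+,v^-\rangle$ be a model and $\mathfrak{M}_d=\langle W,R,v^+_d,v^-_d\rangle$ its dual model. Then for every formula $\phi\in\mathcal{L}_\blacktriangle$ and every $w\in W$: (i) if $\mathfrak{M},w\vDash^+\phi$ and $\mathfrak{M},w\nvDash^-\phi$, then $\mathfrak{M}_d,w\vDash^+\phi$ and $\mathfrak{M}_d,w\nvDash^-\phi$; (ii) if $\mathfrak{M},w\vDash^+\phi$ and $\mathfrak{M},w\vDash^-\phi$, then $\mathfrak{M}_d,w\nvDash^+\phi$ and $\mathfrak{M}_d,w\nvDash^-\phi$; (iii) if $\mathfrak{M},w\nvDash^+\phi$ and $\mathfrak{M},w\nvDash^-\phi$, then $\mathfrak{M}_d,w\vDash^+\phi$ and $\mathfrak{M}_d,w\vDash^-\phi$; (iv) if $\mathfrak{M},w\nvDash^+\phi$ and $\mathfrak{M},w\vDash^-\phi$, then $\mathfrak{M}_d,w\nvDash^+\phi$ and $\mathfrak{M}_d,w\vDash^-\phi$.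
   Context: Formulas of $\mathcal{L}_\blacktriangle$ are built from a countable set $\mathsf{Var}$ of propositional variables by $\phi::=p\mid\neg\phi\mid\phi\wedge\phi\mid\phi\vee\phi\mid\blacktriangle\phi$. A frame is $\langle W,R\rangle$ with $W\neq\varnothing$ and $R\subseteq W\times W$; a model is $\mathfrak{M}=\langle W,R,v^+,v^-\rangle$ with $v^+,v^-:\mathsf{Var}\to 2^W$ (support of truth and of falsity; independent of each other). Two relations $\vDash^+$ (true) and $\vDash^-$ (false) are defined by: $w\vDash^+p$ iff $w\in v^+(p)$; $w\vDash^-p$ iff $w\in v^-(p)$; $w\vDash^+\neg\phi$ iff $w\vDash^-\phi$; $w\vDash^-\neg\phi$ iff $w\vDash^+\phi$; $w\vDash^+\phi_1\wedge\phi_2$ iff both $w\vDash^+\phi_i$; $w\vDash^-\phi_1\wedge\phi_2$ iff some $w\vDash^-\phi_i$; $w\vDash^+\phi_1\vee\phi_2$ iff some $w\vDash^+\phi_i$; $w\vDash^-\phi_1\vee\phi_2$ iff both $w\vDash^-\phi_i$. Further, $\mathfrak{M},w_0\vDash^+\blacktriangle\phi$ iff (a) for all $w_1,w_2$ with $Rw_0w_1$ and $Rw_0w_2$: ($w_1\vDash^+\phi\Rightarrow w_2\vDash^+\phi$) and ($w_1\vDash^-\phi\Rightarrow w_2\vDash^-\phi$), and (b) for all $w_1$ with $Rw_0w_1$: $w_1\vDash^+\phi$ or $w_1\vDash^-\phi$. And $\mathfrak{M},w_0\vDash^-\blacktriangle\phi$ iff there exist $w_1,w_2$ with $Rw_0w_1$,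 $Rw_0w_2$ such that either ($w_1\vDash^+\phi$ and $w_2\nvDash^+\phi$), or ($w_1\vDash^-\phi$ and $w_2\nvDash^-\phi$), or ($w_1\vDash^+\phi$ and $w_2\vDash^-\phi$). The dual model $\mathfrak{M}_d$ of $\mathfrak{M}$ has the same frame and, for each variable $p$ and state $w$: if $w\in v^+(p)\setminus v^-(p)$ then $w\in v^+_d(p)\setminus v^-_d(p)$; if $w\in v^+(p)\cap v^-(p)$ then $w\notin v^+_d(p)\cup v^-_d(p)$; if $w\notin v^+(p)\cup v^-(p)$ then $w\in v^+_d(p)\cap v^-_d(p)$; if $w\in v^-(p)\setminus v^+(p)$ then $w\in v^-_d(p)\setminus v^+_d(p)$. -}

module Defs where

open import Data.Nat using (ℕ)
open import Data.Product using (_×_; Σ-syntax)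
open import Data.Sum using (_⊎_)
open import Relation.Nullary using (¬_)

Var : Set
Var = ℕ

data Form : Set where
  var  : Var → Form
  ¬'_  : Form → Form
  _∧'_ : Form → Form → Form
  _∨'_ : Form → Form → Form
  ▲_   : Form → Form

record Frame : Set₁ where
  field
    W     : Set
    R     : W → W → Set
    inhab : W

Valuation : Frame → Set₁
Valuation F = Var → Frame.W F → Set

record Model : Set₁ where
  constructor model
  field
    frame : Frame
    v⁺ v⁻ : Valuation frame
  open Frame frame public

module _ (M : Model) where
  open Model M

  mutual
    Sat⁺ : W → Form → Set
    Sat⁺ w (var p)   = v⁺ p w
    Sat⁺ w (¬' φ)    = Sat⁻ w φ
    Sat⁺ w (φ ∧' ψ)  = Sat⁺ w φ × Sat⁺ w ψ
    Sat⁺ w (φ ∨' ψ)  = Sat⁺ w φ ⊎ Sat⁺ w ψ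
    Sat⁺ w₀ (▲ φ)    =
      ((w₁ w₂ : W) → R w₀ w₁ → R w₀ w₂ →
         (Sat⁺ w₁ φ → Sat⁺ w₂ φ) × (Sat⁻ w₁ φ → Sat⁻ w₂ φ))
      × ((w₁ : W) → R w₀ w₁ → Sat⁺ w₁ φ ⊎ Sat⁻ w₁ φ)

    Sat⁻ : W → Form → Set
    Sat⁻ w (var p)   = v⁻ p w
    Sat⁻ w (¬' φ)    = Sat⁺ w φ
    Sat⁻ w (φ ∧' ψ)  = Sat⁻ w φ ⊎ Sat⁻ w ψ
    Sat⁻ w (φ ∨' ψ)  = Sat⁻ w φ × Sat⁻ w ψ
    Sat⁻ w₀ (▲ φ)    =
      Σ[ w₁ ∈ W ] Σ[ w₂ ∈ W ] (R w₀ w₁ × R w₀ w₂ ×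
        ((Sat⁺ w₁ φ × ¬ Sat⁺ w₂ φ) ⊎ (Sat⁻ w₁ φ × ¬ Sat⁻ w₂ φ)
                                  ⊎ (Sat⁺ w₁ φ × Sat⁻ w₂ φ)))

record IsDual (F : Frame) (v⁺ v⁻ vd⁺ vd⁻ : Valuation F) : Set where
  open Frame F
  field
    tt→tt : ∀ p (w : W) → v⁺ p w → ¬ v⁻ p w → vd⁺ p w × ¬ vd⁻ p w
    bb→nn : ∀ p (w : W) → v⁺ p w → v⁻ p w → ¬ vd⁺ p w × ¬ vd⁻ p w
    nn→bb : ∀ p (w : W) → ¬ v⁺ p w → ¬ v⁻ p w → vd⁺ p w × vd⁻ p w
    ff→ff : ∀ p (w : W) → ¬ v⁺ p w → v⁻ p w → ¬ vd⁺ p w × vd⁻ p w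

{-# OPTIONS --safe #-}
-- In the dual model every atom is true exactly where it was not false, and
-- false exactly where it was not true: vd⁺ p = W ∖ v⁻ p and vd⁻ p = W ∖ v⁺ p.
-- Classically this relationship between the truth/falsity supports is preserved
-- by all connectives, ▲ included, so it holds for every formula; the four cases
-- of the theorem are its instances.
module Submission where

open import Defs
open import Data.Product using (_×_; _,_; proj₁; proj₂; swap; zip′; Σ-syntax)
open import Data.Sum using (_⊎_; inj₁; inj₂)
open import Function using (_∘_)
open import Function.Bundles using (_⇔_; mk⇔; Equivalence)
open import Relation.Nullary using (¬_; yes; no)
open import Relation.Nullary.Negation using (_¬-⊎_)
open import Level using (0ℓ)
open import Axiom.ExcludedMiddle using (ExcludedMiddle)
open import Axiom.DoubleNegationElimination using (em⇒dne)

open Equivalence using (to; from)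

record Bilateral (W : Set) : Set₁ where
  constructor bilateral
  field
    holds fails : W → Set

open Bilateral

⟦_⟧ : Form → (M : Model) → Bilateral (Model.W M)
⟦ φ ⟧ M = bilateral (λ w → Sat⁺ M w φ) (λ w → Sat⁻ M w φ)

-- The ▲-clauses of Sat⁺/Sat⁻ abstracted over the supports of the argument, so
-- that ⟦ ▲ φ ⟧ M is definitionally ▲-bilateral R (⟦ φ ⟧ M).
module _ {W : Set} (R : W → W → Set) where

  ▲⁺ : Bilateral W → W → Set
  ▲⁺ P w₀ =
    ((w₁ w₂ : W) → R w₀ w₁ → R w₀ w₂ →
       (holds P w₁ → holds P w₂) × (fails P w₁ → fails P w₂))
    × ((w₁ : W) → R w₀ w₁ → holds P w₁ ⊎ fails P w₁)

  ▲⁻ : Bilateral W → W → Set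
  ▲⁻ P w₀ =
    Σ[ w₁ ∈ W ] Σ[ w₂ ∈ W ] (R w₀ w₁ × R w₀ w₂ ×
      ((holds P w₁ × ¬ holds P w₂) ⊎ (fails P w₁ × ¬ fails P w₂)
                                   ⊎ (holds P w₁ × fails P w₂)))

  ▲-bilateral : Bilateral W → Bilateral W
  ▲-bilateral P = bilateral (▲⁺ P) (▲⁻ P)

_IsDualOf_ : {W : Set} → Bilateral W → Bilateral W → Set
Q IsDualOf P = ∀ w → (holds Q w ⇔ (¬ fails P w)) × (fails Q w ⇔ (¬ holds P w))

module Classical (em : ExcludedMiddle 0ℓ) where

  ⇔¬-sym : {A B : Set} → A ⇔ (¬ B) → B ⇔ (¬ A)
  ⇔¬-sym e = mk⇔ (λ b a → to e a b) (λ ¬a → em⇒dne em (¬a ∘ from e))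

  ×-⇔¬⊎ : {A B C D : Set} → A ⇔ (¬ B) → C ⇔ (¬ D) → (A × C) ⇔ (¬ (B ⊎ D))
  ×-⇔¬⊎ e e′ = mk⇔ (λ (a , c) → to e a ¬-⊎ to e′ c)
                    (λ ¬b⊎d → from e (¬b⊎d ∘ inj₁) , from e′ (¬b⊎d ∘ inj₂))

  ⊎-⇔¬× : {A B C D : Set} → A ⇔ (¬ B) → C ⇔ (¬ D) → (A ⊎ C) ⇔ (¬ (B × D))
  ⊎-⇔¬× {A} {B} {C} {D} e e′ = mk⇔ refute prove
    where
    refute : A ⊎ C → ¬ (B × D)
    refute (inj₁ a) (b , _) = to e a b
    refute (inj₂ c) (_ , d) = to e′ c d
    prove : ¬ (B × D) → A ⊎ C
    prove ¬b×d with em {B}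
    ... | yes b = inj₂ (from e′ (λ d → ¬b×d (b , d)))
    ... | no ¬b = inj₁ (from e ¬b)

  IsDualOf-sym : {W : Set} {P Q : Bilateral W} → Q IsDualOf P → P IsDualOf Q
  IsDualOf-sym dual w = let (t , f) = dual w in ⇔¬-sym f , ⇔¬-sym t

  module _ {W : Set} (R : W → W → Set) {P Q : Bilateral W} (dual : Q IsDualOf P) where

    private
      holds⇔ : ∀ u → holds Q u ⇔ (¬ fails P u)
      holds⇔ = proj₁ ∘ dual
      fails⇔ : ∀ u → fails Q u ⇔ (¬ holds P u)
      fails⇔ = proj₂ ∘ dual

    ▲⁺-dual : ∀ w → ▲⁺ R Q w ⇔ (¬ ▲⁻ R P w)
    ▲⁺-dual w = mk⇔ refute prove
      where
      refute : ▲⁺ R Q w → ¬ ▲⁻ R P w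
      refute (mono , _) (w₁ , w₂ , r₁ , r₂ , inj₁ (h₁ , ¬h₂)) =
        to (fails⇔ w₁) (proj₂ (mono w₂ w₁ r₂ r₁) (from (fails⇔ w₂) ¬h₂)) h₁
      refute (mono , _) (w₁ , w₂ , r₁ , r₂ , inj₂ (inj₁ (f₁ , ¬f₂))) =
        to (holds⇔ w₁) (proj₁ (mono w₂ w₁ r₂ r₁) (from (holds⇔ w₂) ¬f₂)) f₁
      refute (mono , total) (w₁ , w₂ , r₁ , r₂ , inj₂ (inj₂ (h₁ , f₂))) with total w₁ r₁
      ... | inj₁ q₁ = to (holds⇔ w₂) (proj₁ (mono w₁ w₂ r₁ r₂) q₁) f₂
      ... | inj₂ q₁ = to (fails⇔ w₁) q₁ h₁

      prove : ¬ ▲⁻ R P w → ▲⁺ R Q w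
      prove ¬▲⁻ = mono , total
        where
        mono : (w₁ w₂ : W) → R w w₁ → R w w₂ →
               (holds Q w₁ → holds Q w₂) × (fails Q w₁ → fails Q w₂)
        mono w₁ w₂ r₁ r₂ =
            (λ q₁ → from (holds⇔ w₂) λ f₂ →
               ¬▲⁻ (w₂ , w₁ , r₂ , r₁ , inj₂ (inj₁ (f₂ , to (holds⇔ w₁) q₁))))
          , (λ q₁ → from (fails⇔ w₂) λ h₂ →
               ¬▲⁻ (w₂ , w₁ , r₂ , r₁ , inj₁ (h₂ , to (fails⇔ w₁) q₁)))
        total : (w₁ : W) → R w w₁ → holds Q w₁ ⊎ fails Q w₁
        total w₁ r₁ with em {fails P w₁}
        ... | no ¬f₁ = inj₁ (from (holds⇔ w₁) ¬f₁)
        ... | yes f₁ = inj₂ (from (fails⇔ w₁) λ h₁ →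
                              ¬▲⁻ (w₁ , w₁ , r₁ , r₁ , inj₂ (inj₂ (h₁ , f₁))))

  -- The falsity half is the truth half for the classically symmetric pair P, Q.
  ▲-dual : {W : Set} (R : W → W → Set) {P Q : Bilateral W} →
           Q IsDualOf P → ▲-bilateral R Q IsDualOf ▲-bilateral R P
  ▲-dual R dual w = ▲⁺-dual R dual w , ⇔¬-sym (▲⁺-dual R (IsDualOf-sym dual) w)

  module _ (F : Frame) (v⁺ v⁻ vd⁺ vd⁻ : Valuation F) where

    IsDual⇒IsDualOf : IsDual F v⁺ v⁻ vd⁺ vd⁻ →
                      ∀ p → bilateral (vd⁺ p) (vd⁻ p) IsDualOf bilateral (v⁺ p) (v⁻ p)
    IsDual⇒IsDualOf isDual p w = mk⇔ refute⁺ prove⁺ , mk⇔ refute⁻ prove⁻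
      where
      open IsDual isDual
      refute⁺ : vd⁺ p w → ¬ v⁻ p w
      refute⁺ d f with em {v⁺ p w}
      ... | yes t = proj₁ (bb→nn p w t f) d
      ... | no ¬t = proj₁ (ff→ff p w ¬t f) d
      prove⁺ : ¬ v⁻ p w → vd⁺ p w
      prove⁺ ¬f with em {v⁺ p w}
      ... | yes t = proj₁ (tt→tt p w t ¬f)
      ... | no ¬t = proj₁ (nn→bb p w ¬t ¬f)
      refute⁻ : vd⁻ p w → ¬ v⁺ p w
      refute⁻ d t with em {v⁻ p w}
      ... | yes f = proj₂ (bb→nn p w t f) d
      ... | no ¬f = proj₂ (tt→tt p w t ¬f) d
      prove⁻ : ¬ v⁺ p w → vd⁻ p w
      prove⁻ ¬t with em {v⁻ p w}
      ... | yes f = proj₂ (ff→ff p w ¬t f)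
      ... | no ¬f = proj₂ (nn→bb p w ¬t ¬f)

    Sat-dual : (∀ p → bilateral (vd⁺ p) (vd⁻ p) IsDualOf bilateral (v⁺ p) (v⁻ p)) →
               ∀ φ → ⟦ φ ⟧ (model F vd⁺ vd⁻) IsDualOf ⟦ φ ⟧ (model F v⁺ v⁻)
    Sat-dual atoms (var p)   = atoms p
    Sat-dual atoms (¬' φ)    = swap ∘ Sat-dual atoms φ
    Sat-dual atoms (φ ∧' ψ) w =
      zip′ ×-⇔¬⊎ ⊎-⇔¬× (Sat-dual atoms φ w) (Sat-dual atoms ψ w)
    Sat-dual atoms (φ ∨' ψ) w =
      zip′ ⊎-⇔¬× ×-⇔¬⊎ (Sat-dual atoms φ w) (Sat-dual atoms ψ w)
    Sat-dual atoms (▲ φ)     = ▲-dual (Frame.R F) (Sat-dual atoms φ)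

lemma1 : ExcludedMiddle 0ℓ →
    (F : Frame) (v⁺ v⁻ vd⁺ vd⁻ : Valuation F) →
    IsDual F v⁺ v⁻ vd⁺ vd⁻ →
    (φ : Form) (w : Frame.W F) →
    ((Sat⁺ (model F v⁺ v⁻) w φ → ¬ Sat⁻ (model F v⁺ v⁻) w φ →
        Sat⁺ (model F vd⁺ vd⁻) w φ × ¬ Sat⁻ (model F vd⁺ vd⁻) w φ)
    × (Sat⁺ (model F v⁺ v⁻) w φ → Sat⁻ (model F v⁺ v⁻) w φ →
        ¬ Sat⁺ (model F vd⁺ vd⁻) w φ × ¬ Sat⁻ (model F vd⁺ vd⁻) w φ)
    × (¬ Sat⁺ (model F v⁺ v⁻) w φ → ¬ Sat⁻ (model F v⁺ v⁻) w φ →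
        Sat⁺ (model F vd⁺ vd⁻) w φ × Sat⁻ (model F vd⁺ vd⁻) w φ)
    × (¬ Sat⁺ (model F v⁺ v⁻) w φ → Sat⁻ (model F v⁺ v⁻) w φ →
        ¬ Sat⁺ (model F vd⁺ vd⁻) w φ × Sat⁻ (model F vd⁺ vd⁻) w φ))
lemma1 em F v⁺ v⁻ vd⁺ vd⁻ isDual φ w
  with Classical.Sat-dual em F v⁺ v⁻ vd⁺ vd⁻
         (Classical.IsDual⇒IsDualOf em F v⁺ v⁻ vd⁺ vd⁻ isDual) φ w
... | holds⇔ , fails⇔ =
    (λ t ¬f → from holds⇔ ¬f , (λ fd → to fails⇔ fd t))
  , (λ t f → (λ td → to holds⇔ td f) , (λ fd → to fails⇔ fd t))
  , (λ ¬t ¬f → from holds⇔ ¬f , from fails⇔ ¬t)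
  , (λ ¬t f → (λ td → to holds⇔ td f) , from fails⇔ ¬t)
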